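{- Let $n,r$ be positive integers with $r\geq 2$. If $\chi$ is a palindromic Gallai-Schur $r$-coloring of $[1,n]$, then $\psi=\langle \chi, r+1,\chi, r+2,\chi, r+2,\chi\rangle$ is a Gallai-Schur $(r+2)$-coloring of $[1,4n+3]$.
   Context: $[1,n]=\{1,\dots,n\}$. An $r$-coloring of $[1,n]$ is a function $\chi:[1,n]\to\{1,\dots,r\}$. Under $\chi$, a Gallai-Schur triple is a triple $(x,y,z)$ with $x,y,z\in[1,n]$, $x\leq y$, $x+y=z$, and either $\chi(x)=\chi(y)=\chi(z)$ or $\chi(x),\chi(y),\chi(z)$ pairwise distinct. $\chi$ is a Gallai-Schur coloring if it has no Gallai-Schur triple, and palindromic if $\chi(i)=\chi(n+1-i)$ for all $i\in[1,n]$. For a coloring $\chi$ of $[1,n]$ and colors $c_1,\dots,c_m$, the concatenation $\langle \chi,c_1,\chi,c_2,\dots,c_m,\chi\rangle$ is the coloring $\psi$ of $[1,(m+1)n+m]$ with $\psi(j(n+1))=c_j$ for $j\in[1,m]$ and $\psi(i+(j-1)(n+1))=\chi(i)$ for $i\in[1,n]$, $j\in[1,m+1]$. -}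

module Defs where

open import Data.Nat using (ℕ; zero; suc; _+_; _*_; _∸_; _≤_; _<_; _≤ᵇ_; _≡ᵇ_)
open import Data.Bool using (if_then_else_)
open import Data.List using (List; []; _∷_)
open import Data.Product using (_×_)
open import Data.Sum using (_⊎_)
open import Relation.Binary.PropositionalEquality using (_≡_; _≢_)
open import Relation.Nullary using (¬_)

-- A coloring is a function ℕ → ℕ; only its values on [1,n] matter.
-- χ is an r-coloring of [1,n] if χ(i) ∈ {1,…,r} for all i ∈ [1,n].
IsColoring : ℕ → ℕ → (ℕ → ℕ) → Set
IsColoring r n χ = ∀ i → 1 ≤ i → i ≤ n → (1 ≤ χ i × χ i ≤ r)

GSTriple : ℕ → (ℕ → ℕ) → ℕ → ℕ → ℕ → Set
GSTriple n χ x y z =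
  1 ≤ x × x ≤ n × 1 ≤ y × y ≤ n × 1 ≤ z × z ≤ n × x ≤ y × x + y ≡ z ×
  ((χ x ≡ χ y × χ y ≡ χ z) ⊎ (χ x ≢ χ y × χ y ≢ χ z × χ x ≢ χ z))

IsGallaiSchur : ℕ → ℕ → (ℕ → ℕ) → Set
IsGallaiSchur r n χ = IsColoring r n χ × (∀ x y z → ¬ GSTriple n χ x y z)

Palindromic : ℕ → (ℕ → ℕ) → Set
Palindromic n χ = ∀ i → 1 ≤ i → i ≤ n → χ i ≡ χ (suc n ∸ i)

-- Concatenation ⟨χ, c₁, χ, c₂, …, cₘ, χ⟩ with cs = c₁ ∷ … ∷ cₘ ∷ []:
-- positions 1..n get χ, position n+1 gets c₁, the rest is shifted by n+1.
concat : ℕ → (ℕ → ℕ) → List ℕ → ℕ → ℕ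
concat n χ [] k = χ k
concat n χ (c ∷ cs) k =
  if k ≤ᵇ n then χ k
  else if k ≡ᵇ suc n then c
  else concat n χ cs (k ∸ suc n)

-- Write the points of ψ as q(n+1) + i with 0 ≤ i ≤ n: for i ≥ 1 the colour is χ(i), the
-- separators q(n+1) carry colours above r, and offsets add up modulo a carry of n+1.
-- Two separators sum to a separator, and r+1, r+2, r+2 is a Gallai–Schur colouring of
-- [1,3]. A separator plus a block point i gives colours {c, χ(i), χ(i)} with c ≠ χ(i).
-- For two block points i, j: without carry the triple is a χ-triple; if i + j = n+1,
-- palindromy gives χ(i) = χ(j), while the sum is a separator; and if i + j = n+1+t,
-- palindromy turns the triple into the χ-triple t + (n+1−j) = i.

module Submission where

open import Defs
open import Data.Nat using (ℕ; zero; suc; _+_; _*_; _∸_; _≤_; _<_; _≤ᵇ_; _≡ᵇ_; z≤n; s≤s; s≤s⁻¹)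
open import Data.Nat.Properties
open import Data.Nat.DivMod using (_/_; _%_; m≡m%n+[m/n]*n; m%n<n; m<n*o⇒m/o<n)
open import Data.Nat.Tactic.RingSolver using (solve-∀)
open import Data.Bool using (true; false; T; if_then_else_)
open import Data.Fin using (Fin; toℕ) renaming (zero to fzero; suc to fsuc)
open import Data.List using ([]; _∷_; length; lookup)
open import Data.Empty using (⊥-elim)
open import Data.Product using (_×_; _,_; proj₁; proj₂)
open import Data.Sum using (_⊎_; inj₁; inj₂)
open import Function using (_∘_; case_of_)
open import Relation.Binary using (tri<; tri≈; tri>)
open import Relation.Nullary using (¬_; contradiction)
open import Relation.Binary.PropositionalEquality

GSColours : ℕ → ℕ → ℕ → Set
GSColours a b c = (a ≡ b × b ≡ c) ⊎ (a ≢ b × b ≢ c × a ≢ c)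

module _ {a b c : ℕ} where

  GSColours-swap₁₂ : GSColours a b c → GSColours b a c
  GSColours-swap₁₂ (inj₁ (a≡b , b≡c))         = inj₁ (sym a≡b , trans a≡b b≡c)
  GSColours-swap₁₂ (inj₂ (a≢b , b≢c , a≢c)) = inj₂ (≢-sym a≢b , a≢c , b≢c)

  GSColours-swap₁₃ : GSColours a b c → GSColours c b a
  GSColours-swap₁₃ (inj₁ (a≡b , b≡c))         = inj₁ (sym b≡c , sym a≡b)
  GSColours-swap₁₃ (inj₂ (a≢b , b≢c , a≢c)) = inj₂ (≢-sym b≢c , ≢-sym a≢b , ≢-sym a≢c)

GSColours-cong : ∀ {a b c a′ b′ c′} → a ≡ a′ → b ≡ b′ → c ≡ c′ →
                 GSColours a b c → GSColours a′ b′ c′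
GSColours-cong refl refl refl colours = colours

¬GSColours-aab : ∀ {a b} → a ≢ b → ¬ GSColours a a b
¬GSColours-aab a≢b (inj₁ (_ , a≡b))    = a≢b a≡b
¬GSColours-aab a≢b (inj₂ (a≢a , _ , _)) = a≢a refl

¬GSColours-abb : ∀ {a b} → a ≢ b → ¬ GSColours a b b
¬GSColours-abb a≢b (inj₁ (a≡b , _))    = a≢b a≡b
¬GSColours-abb a≢b (inj₂ (_ , b≢b , _)) = b≢b refl

¬GSColours-aba : ∀ {a b} → a ≢ b → ¬ GSColours a b a
¬GSColours-aba a≢b = ¬GSColours-abb (≢-sym a≢b) ∘ GSColours-swap₁₂

GSTriple-free⇒GSColours-free : ∀ {n κ} → (∀ x y z → ¬ GSTriple n κ x y z) →
  ∀ {x y} → 1 ≤ x → 1 ≤ y → x + y ≤ n → ¬ GSColours (κ x) (κ y) (κ (x + y))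
GSTriple-free⇒GSColours-free {n} triple-free {x} {y} 1≤x 1≤y x+y≤n colours =
  case ≤-total x y of λ
    { (inj₁ x≤y) → triple-free x y (x + y)
        (1≤x , x≤n , 1≤y , y≤n , 1≤x+y , x+y≤n , x≤y , refl , colours)
    ; (inj₂ y≤x) → triple-free y x (x + y)
        (1≤y , y≤n , 1≤x , x≤n , 1≤x+y , x+y≤n , y≤x , +-comm y x , GSColours-swap₁₂ colours)
    }
  where
    x≤n = m+n≤o⇒m≤o x x+y≤n
    y≤n = m+n≤o⇒n≤o x x+y≤n
    1≤x+y = ≤-trans 1≤x (m≤m+n x y)

-- In a concatenation of blocks of length n, point n q i is the i-th point after the q-th
-- separator; point n q 0 is the q-th separator itself and point n m n the last point.
point : ℕ → ℕ → ℕ → ℕ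
point n q i = q * suc n + i

point-+ : ∀ n a b i j → point n a i + point n b j ≡ point n (a + b) (i + j)
point-+ = semiring-identity
  where
    -- The ring solver does not unfold point.
    semiring-identity : ∀ n a b i j →
      (a * suc n + i) + (b * suc n + j) ≡ (a + b) * suc n + (i + j)
    semiring-identity = solve-∀

point-carry : ∀ n q t → point n q (suc n + t) ≡ point n (suc q) t
point-carry n q t =
  trans (sym (+-assoc (q * suc n) (suc n) t)) (cong (_+ t) (+-comm (q * suc n) (suc n)))

point-suc : ∀ n q i → point n (suc q) i ≡ suc n + point n q i
point-suc n q i = +-assoc (suc n) (q * suc n) i

suc-point-last : ∀ n m → suc (point n m n) ≡ suc m * suc n
suc-point-last n m = trans (sym (+-suc (m * suc n) n)) (+-comm (m * suc n) (suc n))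

point-bound : ∀ {n m} q i → point n q i ≤ point n m n → q ≤ m
point-bound {n} {m} q i ≤last = s≤s⁻¹ (*-cancelʳ-< (suc n) q (suc m) (begin-strict
  q * suc n       ≤⟨ m≤m+n (q * suc n) i ⟩
  point n q i     ≤⟨ ≤last ⟩
  point n m n     <⟨ ≤-reflexive (suc-point-last n m) ⟩
  suc m * suc n   ∎))
  where open ≤-Reasoning

data Position (n m : ℕ) : ℕ → Set where
  block     : ∀ q i → q ≤ m → 1 ≤ i → i ≤ n → Position n m (point n q i)
  separator : ∀ q → 1 ≤ q → q ≤ m → Position n m (point n q 0)

position : ∀ {n m k} → 1 ≤ k → k ≤ point n m n → Position n m k
position {n} {m} {k} 1≤k k≤last =
  subst (Position n m) k-divMod (classify (k / suc n) (k % suc n) q≤m (s≤s⁻¹ (m%n<n k (suc n)))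
    (subst (1 ≤_) (sym k-divMod) 1≤k))
  where
    k-divMod : point n (k / suc n) (k % suc n) ≡ k
    k-divMod = trans (+-comm _ (k % suc n)) (sym (m≡m%n+[m/n]*n k (suc n)))

    q≤m : k / suc n ≤ m
    q≤m = s≤s⁻¹ (m<n*o⇒m/o<n (subst (k <_) (suc-point-last n m) (s≤s k≤last)))

    classify : ∀ q i → q ≤ m → i ≤ n → 1 ≤ point n q i → Position n m (point n q i)
    classify zero    zero    _   _   ()
    classify (suc q) zero    q≤m _   _ = separator (suc q) (s≤s z≤n) q≤m
    classify q       (suc i) q≤m i≤n _ = block q (suc i) q≤m (s≤s z≤n) i≤n

module _ {n : ℕ} {χ : ℕ → ℕ} where

  concat-head : ∀ {c cs k} → k ≤ n → concat n χ (c ∷ cs) k ≡ χ k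
  concat-head {k = k} k≤n with k ≤ᵇ n in k≤ᵇn
  ... | true  = refl
  ... | false = ⊥-elim (subst T k≤ᵇn (≤⇒≤ᵇ k≤n))

  private
    concat-beyond-head : ∀ {c cs k} → n < k →
      concat n χ (c ∷ cs) k ≡ (if k ≡ᵇ suc n then c else concat n χ cs (k ∸ suc n))
    concat-beyond-head {k = k} n<k with k ≤ᵇ n in k≤ᵇn
    ... | true  = contradiction (≤ᵇ⇒≤ k n (subst T (sym k≤ᵇn) _)) (<⇒≱ n<k)
    ... | false = refl

  concat-first-separator : ∀ {c cs} → concat n χ (c ∷ cs) (suc n) ≡ c
  concat-first-separator {c} {cs} rewrite concat-beyond-head {c} {cs} (≤-refl {suc n})
    with n ≡ᵇ n in n≡ᵇn
  ... | true  = refl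
  ... | false = ⊥-elim (subst T n≡ᵇn (≡⇒≡ᵇ n n refl))

  concat-tail : ∀ {c cs k} → 1 ≤ k → concat n χ (c ∷ cs) (suc n + k) ≡ concat n χ cs k
  concat-tail {c} {cs} {k} 1≤k rewrite concat-beyond-head {c} {cs} (s≤s (m≤m+n n k))
    with n + k ≡ᵇ n in n+k≡ᵇn
  ... | true  = contradiction (≡ᵇ⇒≡ (n + k) n (subst T (sym n+k≡ᵇn) _)) (>⇒≢ (m<m+n n 1≤k))
  ... | false = cong (concat n χ cs) (m+n∸m≡n (suc n) k)

  concat-block : ∀ cs q i → q ≤ length cs → 1 ≤ i → i ≤ n →
                 concat n χ cs (point n q i) ≡ χ i
  concat-block []       zero    i _ _ _   = refl
  concat-block (c ∷ cs) zero    i _ _ i≤n = concat-head {c} {cs} i≤n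
  concat-block (c ∷ cs) (suc q) i (s≤s q≤m) 1≤i i≤n = begin
    concat n χ (c ∷ cs) (point n (suc q) i)   ≡⟨ cong (concat n χ (c ∷ cs)) (point-suc n q i) ⟩
    concat n χ (c ∷ cs) (suc n + point n q i) ≡⟨ concat-tail {c} {cs} (≤-trans 1≤i (m≤n+m i _)) ⟩
    concat n χ cs (point n q i)               ≡⟨ concat-block cs q i q≤m 1≤i i≤n ⟩
    χ i                                       ∎
    where open ≡-Reasoning

  concat-separator : ∀ cs (q : Fin (length cs)) →
                     concat n χ cs (point n (suc (toℕ q)) 0) ≡ lookup cs q
  concat-separator (c ∷ cs) fzero = begin
    concat n χ (c ∷ cs) (point n 1 0)   ≡⟨ cong (concat n χ (c ∷ cs)) (point-suc n 0 0) ⟩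
    concat n χ (c ∷ cs) (suc n + 0)     ≡⟨ cong (concat n χ (c ∷ cs)) (+-identityʳ (suc n)) ⟩
    concat n χ (c ∷ cs) (suc n)         ≡⟨ concat-first-separator {c} {cs} ⟩
    c                                   ∎
    where open ≡-Reasoning
  concat-separator (c ∷ cs) (fsuc q) = begin
    concat n χ (c ∷ cs) (point n (suc q′) 0)   ≡⟨ cong (concat n χ (c ∷ cs)) (point-suc n q′ 0) ⟩
    concat n χ (c ∷ cs) (suc n + point n q′ 0) ≡⟨ concat-tail {c} {cs} (s≤s z≤n) ⟩
    concat n χ cs (point n q′ 0)               ≡⟨ concat-separator cs q ⟩
    lookup cs q                                ∎
    where
      q′ = suc (toℕ q)
      open ≡-Reasoning

module _ {n m r s : ℕ} {χ ψ : ℕ → ℕ}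
  (χ-palindromic : Palindromic n χ) (χ-gallaiSchur : IsGallaiSchur r n χ)
  (ψ-block : ∀ q i → q ≤ m → 1 ≤ i → i ≤ n → ψ (point n q i) ≡ χ i)
  (separators-above-r : ∀ q → 1 ≤ q → q ≤ m → r < ψ (point n q 0))
  (separators-gallaiSchur : IsGallaiSchur s m (λ q → ψ (point n q 0)))
  (r≤s : r ≤ s)
  where

  private
    σ : ℕ → ℕ
    σ q = ψ (point n q 0)

    χ-colours : ∀ {i} → 1 ≤ i → i ≤ n → 1 ≤ χ i × χ i ≤ r
    χ-colours = proj₁ χ-gallaiSchur _

    separator≢block : ∀ {q i} → 1 ≤ q → q ≤ m → 1 ≤ i → i ≤ n → σ q ≢ χ i
    separator≢block 1≤q q≤m 1≤i i≤n =
      >⇒≢ (≤-<-trans (proj₂ (χ-colours 1≤i i≤n)) (separators-above-r _ 1≤q q≤m))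

    ψ-at-block : ∀ {z} q i → z ≡ point n q i → z ≤ point n m n → 1 ≤ i → i ≤ n → ψ z ≡ χ i
    ψ-at-block q i refl z≤last = ψ-block q i (point-bound q i z≤last)

    χ-no-GSColours : ∀ {i j} → 1 ≤ i → 1 ≤ j → i + j ≤ n → ¬ GSColours (χ i) (χ j) (χ (i + j))
    χ-no-GSColours = GSTriple-free⇒GSColours-free (proj₂ χ-gallaiSchur)

    mirror-of-overflow : ∀ {i j t} → j ≤ suc n → i + j ≡ suc n + t → t + (suc n ∸ j) ≡ i
    mirror-of-overflow {i} {j} {t} j≤N i+j≡N+t = +-cancelʳ-≡ j _ _ (begin
      t + (suc n ∸ j) + j  ≡⟨ +-assoc t _ j ⟩
      t + (suc n ∸ j + j)  ≡⟨ cong (t +_) (m∸n+n≡m j≤N) ⟩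
      t + suc n            ≡⟨ +-comm t (suc n) ⟩
      suc n + t            ≡⟨ sym i+j≡N+t ⟩
      i + j                ∎)
      where open ≡-Reasoning

    module _ {a b i j : ℕ} (1≤i : 1 ≤ i) (i≤n : i ≤ n) (1≤j : 1 ≤ j) (j≤n : j ≤ n)
             (z≤last : point n a i + point n b j ≤ point n m n) where

      blocks-no-carry : i + j < suc n → ¬ GSColours (χ i) (χ j) (ψ (point n a i + point n b j))
      blocks-no-carry i+j<N =
        χ-no-GSColours 1≤i 1≤j i+j≤n ∘ GSColours-cong refl refl ψz≡χ[i+j]
        where
          i+j≤n = s≤s⁻¹ i+j<N
          ψz≡χ[i+j] = ψ-at-block (a + b) (i + j) (point-+ n a b i j) z≤last
                                 (≤-trans 1≤i (m≤m+n i j)) i+j≤n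

      blocks-carry-to-separator : i + j ≡ suc n →
                                  ¬ GSColours (χ i) (χ j) (ψ (point n a i + point n b j))
      blocks-carry-to-separator i+j≡N =
        ¬GSColours-aab (≢-sym (separator≢block (s≤s z≤n) c≤m 1≤j j≤n))
        ∘ GSColours-cong χi≡χj refl (cong ψ z≡separator)
        where
          z≡separator : point n a i + point n b j ≡ point n (suc (a + b)) 0
          z≡separator = begin
            point n a i + point n b j    ≡⟨ point-+ n a b i j ⟩
            point n (a + b) (i + j)      ≡⟨ cong (point n (a + b)) i+j≡N+0 ⟩
            point n (a + b) (suc n + 0)  ≡⟨ point-carry n (a + b) 0 ⟩
            point n (suc (a + b)) 0      ∎
            where
              i+j≡N+0 = trans i+j≡N (sym (+-identityʳ (suc n)))
              open ≡-Reasoning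
          c≤m = point-bound (suc (a + b)) 0 (subst (_≤ point n m n) z≡separator z≤last)
          χi≡χj = trans (χ-palindromic i 1≤i i≤n)
                        (cong χ (trans (cong (_∸ i) (sym i+j≡N)) (m+n∸m≡n i j)))

      blocks-carry-into-block : suc n < i + j →
                                ¬ GSColours (χ i) (χ j) (ψ (point n a i + point n b j))
      blocks-carry-into-block N<i+j =
        χ-no-GSColours 1≤t 1≤j′ t+j′≤n
        ∘ GSColours-cong ψz≡χt (χ-palindromic j 1≤j j≤n) (cong χ (sym t+j′≡i))
        ∘ GSColours-swap₁₃
        where
          t = i + j ∸ suc n
          i+j≡N+t = sym (m+[n∸m]≡n (<⇒≤ N<i+j))
          t+j′≡i = mirror-of-overflow (m≤n⇒m≤1+n j≤n) i+j≡N+t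
          t+j′≤n = subst (_≤ n) (sym t+j′≡i) i≤n
          1≤t = m<n⇒0<n∸m N<i+j
          1≤j′ = m<n⇒0<n∸m (s≤s j≤n)
          z≡block = trans (point-+ n a b i j)
                          (trans (cong (point n (a + b)) i+j≡N+t) (point-carry n (a + b) t))
          ψz≡χt = ψ-at-block (suc (a + b)) t z≡block z≤last 1≤t (m+n≤o⇒m≤o t t+j′≤n)

      blocks-no-GSColours : ¬ GSColours (χ i) (χ j) (ψ (point n a i + point n b j))
      blocks-no-GSColours with <-cmp (i + j) (suc n)
      ... | tri< i+j<N _ _ = blocks-no-carry i+j<N
      ... | tri≈ _ i+j≡N _ = blocks-carry-to-separator i+j≡N
      ... | tri> _ _ N<i+j = blocks-carry-into-block N<i+j

    sum-no-GSColours : ∀ {x y} → Position n m x → Position n m y → x + y ≤ point n m n →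
                       ¬ GSColours (ψ x) (ψ y) (ψ (x + y))
    sum-no-GSColours (block a i a≤m 1≤i i≤n) (block b j b≤m 1≤j j≤n) z≤last colours =
      blocks-no-GSColours {a} {b} 1≤i i≤n 1≤j j≤n z≤last
        (GSColours-cong (ψ-block a i a≤m 1≤i i≤n) (ψ-block b j b≤m 1≤j j≤n) refl colours)
    sum-no-GSColours (block a i a≤m 1≤i i≤n) (separator b 1≤b b≤m) z≤last colours =
      ¬GSColours-aba (≢-sym (separator≢block 1≤b b≤m 1≤i i≤n))
        (GSColours-cong (ψ-block a i a≤m 1≤i i≤n) refl
           (ψ-at-block (a + b) i z≡block z≤last 1≤i i≤n) colours)
      where
        z≡block : point n a i + point n b 0 ≡ point n (a + b) i
        z≡block = trans (point-+ n a b i 0) (cong (point n (a + b)) (+-identityʳ i))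
    sum-no-GSColours (separator a 1≤a a≤m) (block b j b≤m 1≤j j≤n) z≤last colours =
      ¬GSColours-abb (separator≢block 1≤a a≤m 1≤j j≤n)
        (GSColours-cong refl (ψ-block b j b≤m 1≤j j≤n)
           (ψ-at-block (a + b) j (point-+ n a b 0 j) z≤last 1≤j j≤n) colours)
    sum-no-GSColours (separator a 1≤a _) (separator b 1≤b _) z≤last colours =
      GSTriple-free⇒GSColours-free (proj₂ separators-gallaiSchur) 1≤a 1≤b
        (point-bound (a + b) 0 (subst (_≤ point n m n) (point-+ n a b 0 0) z≤last))
        (GSColours-cong refl refl (cong ψ (point-+ n a b 0 0)) colours)

    colours-at : ∀ {k} → Position n m k → 1 ≤ ψ k × ψ k ≤ s
    colours-at (block q i q≤m 1≤i i≤n) rewrite ψ-block q i q≤m 1≤i i≤n =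
      proj₁ (χ-colours 1≤i i≤n) , ≤-trans (proj₂ (χ-colours 1≤i i≤n)) r≤s
    colours-at (separator q 1≤q q≤m) = proj₁ separators-gallaiSchur q 1≤q q≤m

  blocks-and-separators-gallaiSchur : IsGallaiSchur s (point n m n) ψ
  blocks-and-separators-gallaiSchur =
    (λ k 1≤k k≤last → colours-at (position 1≤k k≤last)) ,
    λ { x y _ (1≤x , x≤last , 1≤y , y≤last , _ , z≤last , _ , refl , colours) →
          sum-no-GSColours (position 1≤x x≤last) (position 1≤y y≤last) z≤last colours }

∀-[1,3] : ∀ {P : ℕ → Set} → P 1 → P 2 → P 3 → ∀ q → 1 ≤ q → q ≤ 3 → P q
∀-[1,3] p₁ _  _  1 _ _ = p₁
∀-[1,3] _  p₂ _  2 _ _ = p₂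
∀-[1,3] _  _  p₃ 3 _ _ = p₃
∀-[1,3] _  _  _  0 () _
∀-[1,3] _  _  _  (suc (suc (suc (suc q)))) _ (s≤s (s≤s (s≤s ())))

GSTriple-free-[1,3] : ∀ {σ : ℕ → ℕ} → σ 1 ≢ σ 2 → σ 2 ≡ σ 3 → ∀ x y z → ¬ GSTriple 3 σ x y z
GSTriple-free-[1,3] {σ} σ₁≢σ₂ σ₂≡σ₃ x y _ (1≤x , _ , _ , _ , _ , x+y≤3 , x≤y , refl , colours) =
  sums x y 1≤x x≤y x+y≤3 colours
  where
    sums : ∀ x y → 1 ≤ x → x ≤ y → x + y ≤ 3 → ¬ GSColours (σ x) (σ y) (σ (x + y))
    sums 1 0 _ () _
    sums 1 1 _ _ _ = ¬GSColours-aab σ₁≢σ₂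
    sums 1 2 _ _ _ = ¬GSColours-abb σ₁≢σ₂ ∘ GSColours-cong refl refl (sym σ₂≡σ₃)
    sums 1 (suc (suc (suc y))) _ _ (s≤s (s≤s (s≤s ())))
    sums (suc (suc x)) y _ x≤y x+y≤3 _ = <⇒≱ (+-mono-≤ 2≤x (≤-trans 2≤x x≤y)) x+y≤3
      where 2≤x : 2 ≤ suc (suc x)
            2≤x = s≤s (s≤s z≤n)

separators-r+1,r+2,r+2 : ∀ {r} {σ : ℕ → ℕ} → σ 1 ≡ r + 1 → σ 2 ≡ r + 2 → σ 3 ≡ r + 2 →
  (∀ q → 1 ≤ q → q ≤ 3 → r < σ q) × IsGallaiSchur (r + 2) 3 σ
separators-r+1,r+2,r+2 {r} {σ} σ₁ σ₂ σ₃ =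
  (λ q 1≤q q≤3 → proj₁ (in-range q 1≤q q≤3)) ,
  (λ q 1≤q q≤3 → let r<σ , σ≤r+2 = in-range q 1≤q q≤3 in ≤-trans (s≤s z≤n) r<σ , σ≤r+2) ,
  GSTriple-free-[1,3] (λ σ₁≡σ₂ → <⇒≢ (+-monoʳ-< r ≤-refl) (trans (sym σ₁) (trans σ₁≡σ₂ σ₂)))
                      (trans σ₂ (sym σ₃))
  where
    InRange : ℕ → Set
    InRange c = r < c × c ≤ r + 2

    in-range : ∀ q → 1 ≤ q → q ≤ 3 → InRange (σ q)
    in-range = ∀-[1,3] {InRange ∘ σ}
      (subst InRange (sym σ₁) (m<m+n r (s≤s z≤n) , +-monoʳ-≤ r (s≤s z≤n)))
      (subst InRange (sym σ₂) (m<m+n r (s≤s z≤n) , ≤-refl))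
      (subst InRange (sym σ₃) (m<m+n r (s≤s z≤n) , ≤-refl))

lemmaA1 : (n r : ℕ) → 1 ≤ n → 2 ≤ r → (χ : ℕ → ℕ) →
    Palindromic n χ → IsGallaiSchur r n χ →
    IsGallaiSchur (r + 2) (4 * n + 3) (concat n χ (r + 1 ∷ r + 2 ∷ r + 2 ∷ []))
lemmaA1 n r _ _ χ χ-palindromic χ-gallaiSchur =
  subst (λ last → IsGallaiSchur (r + 2) last ψ) (point-3-last n)
    (blocks-and-separators-gallaiSchur χ-palindromic χ-gallaiSchur (concat-block cs)
       (proj₁ separators) (proj₂ separators) (m≤m+n r 2))
  where
    cs = r + 1 ∷ r + 2 ∷ r + 2 ∷ []
    ψ = concat n χ cs

    separators = separators-r+1,r+2,r+2
      (concat-separator {n} {χ} cs fzero)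
      (concat-separator {n} {χ} cs (fsuc fzero))
      (concat-separator {n} {χ} cs (fsuc (fsuc fzero)))

    point-3-last : ∀ n → 3 * suc n + n ≡ 4 * n + 3
    point-3-last = solve-∀
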